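{- If $n$ is strongly matchable and $p$ is a prime not dividing $n$, then $p^{p-1}n$ is strongly matchable.
   Context: For a positive integer $n$, let $D(n)$ be its set of positive divisors and $\tau(n)=|D(n)|$. A coprime arithmetic progression of $N$ integers is a set $\{a+kq:0\le k<N\}$ with integers $a$ and $q\ge1$, $\gcd(a,q)=1$. A positive integer $n$ is strongly matchable if for every coprime arithmetic progression $I$ of $\tau(n)$ integers there is a bijection $\psi:D(n)\to I$ with $\gcd(d,\psi(d))=1$ for all $d\in D(n)$. -}

module Defs where

open import Data.Nat as ℕ using (ℕ; suc; _<_; _≤_; _^_; _∸_)
open import Data.Nat.Divisibility using (_∣_; _∣?_)
open import Data.Nat.Primality using (Prime)
open import Data.Nat.GCD using (gcd)
open import Data.Integer as ℤ using (ℤ; +_; ∣_∣)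
open import Data.Product using (Σ; ∃; _×_; Σ-syntax; proj₁)
open import Data.List using (List; length; filter; upTo)
open import Relation.Nullary.Decidable using (True)
open import Relation.Binary.PropositionalEquality using (_≡_)
open import Function.Bundles using (_⤖_; Bijection)

-- The witness `True (d ∣? n)` is proof-irrelevant, so elements are just numbers d.
-- We additionally require 1 ≤ d ("positive divisor"), relevant only for n = 0.
D : ℕ → Set
D n = Σ[ d ∈ ℕ ] (True (1 ℕ.≤? d) × True (d ∣? n))

τ : ℕ → ℕ
τ n = length (filter (λ d → d ∣? n) (Data.List.map suc (upTo n)))
  where import Data.List

AP : ℤ → ℕ → ℕ → Set
AP a q N = Σ[ x ∈ ℤ ] (Σ[ k ∈ ℕ ] (k < N × x ≡ a ℤ.+ (+ k) ℤ.* (+ q)))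

CoprimeNZ : ℕ → ℤ → Set
CoprimeNZ d x = gcd d ∣ x ∣ ≡ 1

StronglyMatchable : ℕ → Set
StronglyMatchable n =
  (a : ℤ) (q : ℕ) → 1 ≤ q → gcd ∣ a ∣ q ≡ 1 →
  Σ[ ψ ∈ (D n ⤖ AP a q (τ n)) ]
    ((d : D n) → CoprimeNZ (proj₁ d) (proj₁ (Bijection.to ψ d)))

{-# OPTIONS --safe #-}
module Submission where

open import Defs
open import Data.Nat using (ℕ; _*_; _^_; _∸_; _≤_)
open import Data.Nat.Divisibility using (_∣_)
open import Data.Nat.Primality using (Prime)
open import Relation.Nullary using (¬_)

open import Data.Nat using (zero; suc; _+_; _<_; z≤n; s≤s; NonZero; >-nonZero; >-nonZero⁻¹)
import Data.Nat.Properties as ℕₚ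
open import Data.Nat.Divisibility
  using (_∣?_; divides; ∣-trans; m∣m*n; ∣m⇒∣m*n; *-pres-∣; *-cancelˡ-∣; ∣⇒≤)
open import Data.Nat.Coprimality as Coprimality
  using (Coprime; coprime-divisor; coprime⇒gcd≡1; gcd≡1⇒coprime)
open import Data.Nat.Primality
  using (prime⇒irreducible; prime⇒nonZero; ¬prime[0]; ¬prime[1]; euclidsLemma)
open import Data.Integer as ℤ using (ℤ; +_; ∣_∣)
import Data.Integer.Properties as ℤₚ
import Data.Integer.Divisibility.Signed as ℤ∣
open import Data.Integer.Tactic.RingSolver using (solve-∀)
open import Data.Fin as Fin using (Fin; toℕ; fromℕ<)
import Data.Fin.Properties as Finₚ
open import Data.Fin.Permutation as Perm using (Permutation′; _⟨$⟩ʳ_; ↔⇒≡)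
open import Data.List using (List; _∷_; filter; map; upTo; length; lookup)
open import Data.List.Membership.Propositional using (_∈_)
open import Data.List.Membership.Propositional.Properties
  using (∈-filter⁺; ∈-filter⁻; ∈-map⁺; ∈-map⁻; ∈-upTo⁺; ∈-lookup)
open import Data.List.Membership.Setoid.Properties using (unique⇒irrelevant)
open import Data.List.Relation.Unary.Any as Any using ()
open import Data.List.Relation.Unary.Any.Properties using (lookup-index)
open import Data.List.Relation.Unary.Unique.Propositional using (Unique)
import Data.List.Relation.Unary.Unique.Propositional.Properties as Unique
open import Data.Bool.Properties using (T-irrelevant)
open import Data.Product using (Σ-syntax; ∃; _×_; _,_; proj₁; proj₂)
open import Data.Product.Algebra using (×-comm)
open import Data.Product.Function.Dependent.Propositional using (Σ-↔)
open import Data.Sum using (inj₁; inj₂; [_,_]′)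
open import Function using (_∘_; _↔_; _⤖_; Inverse; Bijection; mk↔ₛ′; mk⤖; Injective; Surjective)
open import Function.Construct.Composition using (_↔-∘_)
open import Function.Construct.Symmetry using (↔-sym)
open import Function.Properties.Inverse using (↔⇒⤖)
open import Function.Properties.Bijection using (⤖⇒↔)
open import Relation.Nullary using (yes; no; contradiction)
open import Relation.Nullary.Decidable using (fromWitness; toWitness)
open import Relation.Unary using (Pred; Decidable)
open import Relation.Binary using (Irrelevant)
open import Relation.Binary.PropositionalEquality
  using (_≡_; refl; sym; trans; cong; cong₂; subst; subst₂; setoid; module ≡-Reasoning)

open Inverse using (to; from)

-- Write the divisors of p ^ (p - 1) * n as p ^ i * e with i < p and e ∣ n, and split the
-- progression a + k q (k < p τ(n)) by k = p m + r into the p progressions a + r q + m p q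
-- (m < τ(n)). Since gcd(a, q) = 1, at most one residue r₀ has p ∣ a + r₀ q. Its class is
-- p times the coprime progression (a + r₀ q) / p + m q, and it receives the divisors p ^ 0 * e,
-- which are prime to p. Every other class is a coprime progression none of whose terms is
-- divisible by p, so it can receive the divisors p ^ i * e for any fixed i. In each case the
-- matching comes from the strong matchability of n; the exponents are assigned to the residues
-- by a permutation sending 0 to r₀.

coprime-*ʳ : ∀ {m n o} → Coprime m n → Coprime m o → Coprime m (n * o)
coprime-*ʳ m⊥n m⊥o (d∣m , d∣n*o) =
  m⊥o (d∣m , coprime-divisor (λ (c∣d , c∣n) → m⊥n (∣-trans c∣d d∣m , c∣n)) d∣n*o)

coprime-*ˡ : ∀ {m n o} → Coprime m o → Coprime n o → Coprime (m * n) o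
coprime-*ˡ m⊥o n⊥o = Coprimality.sym (coprime-*ʳ (Coprimality.sym m⊥o) (Coprimality.sym n⊥o))

coprime-^-*ˡ : ∀ {p e x} → Coprime p x → Coprime e x → ∀ i → Coprime (p ^ i * e) x
coprime-^-*ˡ {p} {e} {x} p⊥x e⊥x zero =
  subst (λ m → Coprime m x) (sym (ℕₚ.*-identityˡ e)) e⊥x
coprime-^-*ˡ {p} {e} {x} p⊥x e⊥x (suc i) =
  subst (λ m → Coprime m x) (sym (ℕₚ.*-assoc p (p ^ i) e)) (coprime-*ˡ p⊥x (coprime-^-*ˡ p⊥x e⊥x i))

prime∤⇒coprime : ∀ {p e} → Prime p → ¬ p ∣ e → Coprime e p
prime∤⇒coprime p-prime p∤e (d∣e , d∣p) with prime⇒irreducible p-prime d∣p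
... | inj₁ d≡1 = d≡1
... | inj₂ refl = contradiction d∣e p∤e

∃∈↔Fin-length : ∀ {A : Set} {xs : List A} → Irrelevant (_≡_ {A = A}) → Unique xs →
  (∃ λ x → x ∈ xs) ↔ Fin (length xs)
∃∈↔Fin-length {A} {xs} ≡-irrelevant xs! =
  mk↔ₛ′ (λ (_ , x∈xs) → Any.index x∈xs) (λ i → lookup xs i , ∈-lookup i) (index-∈-lookup xs)
        (λ (_ , x∈xs) → same-point (lookup-index x∈xs) _ x∈xs)
  where
  index-∈-lookup : ∀ xs i → Any.index (∈-lookup {xs = xs} i) ≡ i
  index-∈-lookup (_ ∷ _) Fin.zero = refl
  index-∈-lookup (_ ∷ xs) (Fin.suc i) = cong Fin.suc (index-∈-lookup xs i)

  same-point : ∀ {x y} → x ≡ y → (y∈xs : y ∈ xs) (x∈xs : x ∈ xs) → (y , y∈xs) ≡ (x , x∈xs)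
  same-point refl y∈xs x∈xs = cong (_ ,_) (unique⇒irrelevant (setoid A) ≡-irrelevant xs! y∈xs x∈xs)

permute-witness-to-zero : ∀ {j ℓ} {P : Pred (Fin (suc j)) ℓ} → Decidable P →
  (∀ {x y} → P x → P y → x ≡ y) → Σ[ π ∈ Permutation′ (suc j) ] (∀ i → P (π ⟨$⟩ʳ i) → i ≡ Fin.zero)
permute-witness-to-zero P? P-unique with Finₚ.any? P?
... | no ∄P = Perm.id , λ i P[i] → contradiction (i , P[i]) ∄P
... | yes (r , P[r]) = π , λ i P[πi] → Bijection.injective (↔⇒⤖ π) (P-unique P[πi] P[r])
  where
  π = Perm.transpose Fin.zero r

interleave : ∀ {p N} {X : Set} → Permutation′ p → (Fin p → X ↔ Fin N) → (Fin p × X) ↔ Fin (N * p)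
interleave {p} {N} σ ψ = ↔-sym (Finₚ.*↔× {N} {p}) ↔-∘ (×-comm _ _ ↔-∘ Σ-↔ σ (λ {i} → ψ i))

toℕ-interleave : ∀ {p N} {X : Set} (σ : Permutation′ p) (ψ : Fin p → X ↔ Fin N) i x →
  toℕ (to (interleave σ ψ) (i , x)) ≡ p * toℕ (to (ψ i) x) + toℕ (σ ⟨$⟩ʳ i)
toℕ-interleave σ ψ i x = Finₚ.toℕ-combine (to (ψ i) x) (σ ⟨$⟩ʳ i)

D-≡ : ∀ {m} {x y : D m} → proj₁ x ≡ proj₁ y → x ≡ y
D-≡ {x = d , a , b} {y = .d , a' , b'} refl = cong₂ (λ u v → d , u , v) (T-irrelevant a a') (T-irrelevant b b')

∤⇒∤divisor : ∀ {p n} → ¬ p ∣ n → (e : D n) → ¬ p ∣ proj₁ e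
∤⇒∤divisor p∤n (_ , _ , e∣n) p∣e = p∤n (∣-trans p∣e (toWitness e∣n))

divisors : ℕ → List ℕ
divisors m = filter (_∣? m) (map suc (upTo m))

divisors-unique : ∀ m → Unique (divisors m)
divisors-unique m = Unique.filter⁺ (_∣? m) (Unique.map⁺ ℕₚ.suc-injective (Unique.upTo⁺ m))

∈-divisors⁺ : ∀ {m d} → 1 ≤ m → 1 ≤ d → d ∣ m → d ∈ divisors m
∈-divisors⁺ {m} {suc d} m≥1 _ d∣m =
  ∈-filter⁺ (_∣? m) (∈-map⁺ suc (∈-upTo⁺ (∣⇒≤ ⦃ >-nonZero m≥1 ⦄ d∣m))) d∣m

∈-divisors⁻ : ∀ {m d} → d ∈ divisors m → 1 ≤ d × d ∣ m
∈-divisors⁻ {m} d∈ with ∈-filter⁻ (_∣? m) {xs = map suc (upTo m)} d∈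
... | d∈suc[upTo] , d∣m with ∈-map⁻ suc d∈suc[upTo]
...   | _ , _ , refl = s≤s z≤n , d∣m

D↔Fin[τ] : ∀ {m} → 1 ≤ m → D m ↔ Fin (τ m)
D↔Fin[τ] {m} m≥1 = ∃∈↔Fin-length ℕₚ.≡-irrelevant (divisors-unique m) ↔-∘ D↔∃∈divisors
  where
  D↔∃∈divisors : D m ↔ (∃ λ d → d ∈ divisors m)
  D↔∃∈divisors = mk↔ₛ′
    (λ (d , 1≤d , d∣m) → d , ∈-divisors⁺ {m} m≥1 (toWitness 1≤d) (toWitness d∣m))
    (λ (d , d∈) → d , fromWitness (proj₁ (∈-divisors⁻ {m} d∈)) , fromWitness (proj₂ (∈-divisors⁻ {m} d∈)))
    (λ (d , d∈) → cong (d ,_) (unique⇒irrelevant (setoid ℕ) ℕₚ.≡-irrelevant (divisors-unique m) _ d∈))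
    (λ _ → D-≡ refl)

^-monoʳ-∣ : ∀ m {i j} → i ≤ j → m ^ i ∣ m ^ j
^-monoʳ-∣ m {i} i≤j with ℕₚ.m≤n⇒∃[o]m+o≡n i≤j
... | o , refl = subst (m ^ i ∣_) (sym (ℕₚ.^-distribˡ-+-* m i o)) (m∣m*n (m ^ o))

∣p^j*n⇒≡p^i*e : ∀ {p n} → Prime p → ∀ j {d} → d ∣ p ^ j * n →
  Σ[ i ∈ ℕ ] i ≤ j × Σ[ e ∈ ℕ ] e ∣ n × d ≡ p ^ i * e
∣p^j*n⇒≡p^i*e {p} {n} p-prime zero {d} d∣n =
  0 , z≤n , d , subst (d ∣_) (ℕₚ.*-identityˡ n) d∣n , sym (ℕₚ.*-identityˡ d)
∣p^j*n⇒≡p^i*e {p} {n} p-prime (suc j) {d} d∣p^[1+j]*n with p ∣? d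
... | yes (divides k refl) =
  let i , i≤j , e , e∣n , k≡p^i*e = ∣p^j*n⇒≡p^i*e p-prime j {k} k∣p^j*n
  in suc i , s≤s i≤j , e , e∣n , (begin
    k * p             ≡⟨ ℕₚ.*-comm k p ⟩
    p * k             ≡⟨ cong (p *_) k≡p^i*e ⟩
    p * (p ^ i * e)   ≡⟨ ℕₚ.*-assoc p (p ^ i) e ⟨
    p * p ^ i * e     ∎)
  where
  open ≡-Reasoning
  k∣p^j*n : k ∣ p ^ j * n
  k∣p^j*n = *-cancelˡ-∣ p ⦃ prime⇒nonZero p-prime ⦄
    (subst₂ _∣_ (ℕₚ.*-comm k p) (ℕₚ.*-assoc p (p ^ j) n) d∣p^[1+j]*n)
... | no p∤d =
  let i , i≤j , rest = ∣p^j*n⇒≡p^i*e p-prime j {d} d∣p^j*n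
  in i , ℕₚ.m≤n⇒m≤1+n i≤j , rest
  where
  d∣p^j*n : d ∣ p ^ j * n
  d∣p^j*n = coprime-divisor (prime∤⇒coprime p-prime p∤d)
    (subst (d ∣_) (ℕₚ.*-assoc p (p ^ j) n) d∣p^[1+j]*n)

p^i*e-injective : ∀ {p} → Prime p → ∀ i i' {e e'} → ¬ p ∣ e → ¬ p ∣ e' →
  p ^ i * e ≡ p ^ i' * e' → i ≡ i' × e ≡ e'
p^i*e-injective p-prime zero zero {e} {e'} _ _ eq =
  refl , trans (sym (ℕₚ.*-identityˡ e)) (trans eq (ℕₚ.*-identityˡ e'))
p^i*e-injective {p} p-prime zero (suc i') {e} {e'} p∤e _ eq =
  contradiction (subst (p ∣_) (trans (sym eq) (ℕₚ.*-identityˡ e)) (∣-trans (m∣m*n (p ^ i')) (m∣m*n e'))) p∤e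
p^i*e-injective {p} p-prime (suc i) zero {e} {e'} _ p∤e' eq =
  contradiction (subst (p ∣_) (trans eq (ℕₚ.*-identityˡ e')) (∣-trans (m∣m*n (p ^ i)) (m∣m*n e))) p∤e'
p^i*e-injective {p} p-prime (suc i) (suc i') {e} {e'} p∤e p∤e' eq
  with p^i*e-injective p-prime i i' p∤e p∤e'
         (ℕₚ.*-cancelˡ-≡ _ _ p ⦃ prime⇒nonZero p-prime ⦄
           (trans (sym (ℕₚ.*-assoc p (p ^ i) e)) (trans eq (ℕₚ.*-assoc p (p ^ i') e'))))
... | refl , e≡e' = refl , e≡e'

Fin×D↔D[p^j*n] : ∀ {p n} → Prime p → ¬ p ∣ n → ∀ j → (Fin (suc j) × D n) ↔ D (p ^ j * n)
Fin×D↔D[p^j*n] {p} {n} p-prime p∤n j = ⤖⇒↔ (mk⤖ (injective , surjective))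
  where
  instance
    p-nonZero : NonZero p
    p-nonZero = prime⇒nonZero p-prime

  p^i*e : Fin (suc j) × D n → D (p ^ j * n)
  p^i*e (i , e , 1≤e , e∣n) = p ^ toℕ i * e ,
    fromWitness (ℕₚ.*-mono-≤ (ℕₚ.m^n>0 p (toℕ i)) (toWitness 1≤e)) ,
    fromWitness (*-pres-∣ (^-monoʳ-∣ p (Finₚ.toℕ≤pred[n] i)) (toWitness e∣n))

  injective : Injective _≡_ _≡_ p^i*e
  injective {i , e} {i' , e'} eq
    with p^i*e-injective p-prime (toℕ i) (toℕ i') (∤⇒∤divisor p∤n e) (∤⇒∤divisor p∤n e') (cong proj₁ eq)
  ... | i≡i' , e≡e' = cong₂ _,_ (Finₚ.toℕ-injective i≡i') (D-≡ e≡e')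

  surjective : Surjective _≡_ _≡_ p^i*e
  surjective (d , 1≤d , d∣p^j*n) with ∣p^j*n⇒≡p^i*e p-prime j (toWitness d∣p^j*n)
  ... | i , i≤j , e , e∣n , refl =
    (fromℕ< (s≤s i≤j) , e , fromWitness 1≤e , fromWitness e∣n) ,
    λ { refl → D-≡ (cong (λ k → p ^ k * e) (Finₚ.toℕ-fromℕ< (s≤s i≤j))) }
    where
    1≤e : 1 ≤ e
    1≤e = >-nonZero⁻¹ e ⦃ ℕₚ.m*n≢0⇒n≢0 (p ^ i) ⦃ >-nonZero (toWitness 1≤d) ⦄ ⦄

term : ℤ → ℕ → ℕ → ℤ
term c q k = c ℤ.+ + k ℤ.* + q

term-+ : ∀ c q r t → term c q (r + t) ≡ term (term c q r) q t
term-+ c q r t = trans (cong (λ z → c ℤ.+ z ℤ.* + q) (ℤₚ.pos-+ r t)) (distrib c (+ r) (+ t) (+ q))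
  where
  distrib : ∀ c r t q → c ℤ.+ (r ℤ.+ t) ℤ.* q ≡ (c ℤ.+ r ℤ.* q) ℤ.+ t ℤ.* q
  distrib = solve-∀

term-residue : ∀ c q p m r → term c q (p * m + r) ≡ term (term c q r) (p * q) m
term-residue c q p m r = begin
  c ℤ.+ + (p * m + r) ℤ.* + q                    ≡⟨ cong (λ z → c ℤ.+ z ℤ.* + q) (ℤₚ.pos-+ (p * m) r) ⟩
  c ℤ.+ (+ (p * m) ℤ.+ + r) ℤ.* + q              ≡⟨ cong (λ z → c ℤ.+ (z ℤ.+ + r) ℤ.* + q) (ℤₚ.pos-* p m) ⟩
  c ℤ.+ (+ p ℤ.* + m ℤ.+ + r) ℤ.* + q            ≡⟨ regroup c (+ p) (+ m) (+ r) (+ q) ⟩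
  (c ℤ.+ + r ℤ.* + q) ℤ.+ + m ℤ.* (+ p ℤ.* + q)  ≡⟨ cong (λ z → term c q r ℤ.+ + m ℤ.* z) (ℤₚ.pos-* p q) ⟨
  term (term c q r) (p * q) m                    ∎
  where
  open ≡-Reasoning
  regroup : ∀ c p m r q → c ℤ.+ (p ℤ.* m ℤ.+ r) ℤ.* q ≡ (c ℤ.+ r ℤ.* q) ℤ.+ m ℤ.* (p ℤ.* q)
  regroup = solve-∀

term-scale : ∀ c q p m → term (c ℤ.* + p) (p * q) m ≡ term c q m ℤ.* + p
term-scale c q p m = trans (cong (λ z → c ℤ.* + p ℤ.+ + m ℤ.* z) (ℤₚ.pos-* p q)) (factor c (+ p) (+ m) (+ q))
  where
  factor : ∀ c p m q → c ℤ.* p ℤ.+ m ℤ.* (p ℤ.* q) ≡ (c ℤ.+ m ℤ.* q) ℤ.* p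
  factor = solve-∀

∣term∧∣step⇒∣start : ∀ {d c q} k → d ∣ ∣ term c q k ∣ → d ∣ q → d ∣ ∣ c ∣
∣term∧∣step⇒∣start {d} {c} {q} k d∣t d∣q = ℤ∣.∣⇒∣ᵤ {+ d} {c}
  (ℤ∣.∣m+n∣n⇒∣m (ℤ∣.∣ᵤ⇒∣ {+ d} {term c q k} d∣t)
                (ℤ∣.∣n⇒∣m*n (+ k) (ℤ∣.∣ᵤ⇒∣ {+ d} {+ q} d∣q)))

∣start∧∣term⇒∣step : ∀ {d c q} k → d ∣ ∣ c ∣ → d ∣ ∣ term c q k ∣ → d ∣ k * q
∣start∧∣term⇒∣step {d} {c} {q} k d∣c d∣t = subst (d ∣_) (ℤₚ.abs-* (+ k) (+ q))
  (ℤ∣.∣⇒∣ᵤ (ℤ∣.∣m+n∣m⇒∣n (ℤ∣.∣ᵤ⇒∣ {+ d} {term c q k} d∣t) (ℤ∣.∣ᵤ⇒∣ {+ d} {c} d∣c)))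

coprime-term : ∀ {c q} → Coprime ∣ c ∣ q → ∀ k → Coprime ∣ term c q k ∣ q
coprime-term {c} c⊥q k (d∣t , d∣q) = c⊥q (∣term∧∣step⇒∣start {c = c} k d∣t d∣q , d∣q)

prime∣term∧<⇒≡0 : ∀ {p c q t} → Prime p → Coprime ∣ c ∣ q → t < p →
  p ∣ ∣ c ∣ → p ∣ ∣ term c q t ∣ → t ≡ 0
prime∣term∧<⇒≡0 {p} {c} {q} {t} p-prime c⊥q t<p p∣c p∣term
  with euclidsLemma t q p-prime (∣start∧∣term⇒∣step {c = c} t p∣c p∣term)
... | inj₂ p∣q = contradiction (subst Prime (c⊥q (p∣c , p∣q)) p-prime) ¬prime[1]
... | inj₁ p∣t with t
...   | zero = refl
...   | suc _ = contradiction (∣⇒≤ p∣t) (ℕₚ.<⇒≱ t<p)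

prime∣term-unique : ∀ {p c q r s} → Prime p → Coprime ∣ c ∣ q → r < p → s < p →
  p ∣ ∣ term c q r ∣ → p ∣ ∣ term c q s ∣ → r ≡ s
prime∣term-unique {p} {c} {q} {r} {s} p-prime c⊥q r<p s<p p∣r p∣s =
  [ (λ r≤s → ordered r≤s s<p p∣r p∣s) , (λ s≤r → sym (ordered s≤r r<p p∣s p∣r)) ]′ (ℕₚ.≤-total r s)
  where
  ordered : ∀ {r s} → r ≤ s → s < p → p ∣ ∣ term c q r ∣ → p ∣ ∣ term c q s ∣ → r ≡ s
  ordered {r} r≤s s<p p∣r p∣s with ℕₚ.m≤n⇒∃[o]m+o≡n r≤s
  ... | t , refl = sym (trans (cong (λ u → r + u) t≡0) (ℕₚ.+-identityʳ r))
    where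
    t≡0 : t ≡ 0
    t≡0 = prime∣term∧<⇒≡0 {c = term c q r} p-prime (coprime-term {c} c⊥q r)
      (ℕₚ.≤-<-trans (ℕₚ.m≤n+m t r) s<p) p∣r (subst (λ z → p ∣ ∣ z ∣) (term-+ c q r t) p∣s)

AP↔Fin : ∀ {c q N} → AP c q N ↔ Fin N
AP↔Fin {c} {q} {N} = mk↔ₛ′ (λ (_ , _ , k<N , _) → fromℕ< k<N) (λ j → point (Finₚ.toℕ<n j))
  (λ j → Finₚ.fromℕ<-toℕ j _) (λ { (_ , k , k<N , refl) → point-cong (Finₚ.toℕ-fromℕ< k<N) })
  where
  point : ∀ {k} → k < N → AP c q N
  point {k} k<N = term c q k , k , k<N , refl

  point-cong : ∀ {k k'} {k<N : k < N} {k'<N : k' < N} → k ≡ k' → point k<N ≡ point k'<N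
  point-cong {k<N = k<N} {k'<N} refl = cong point (ℕₚ.<-irrelevant k<N k'<N)

AP-term : ∀ {c q N} (x : AP c q N) → proj₁ x ≡ term c q (toℕ (to (AP↔Fin {c} {q} {N}) x))
AP-term {c} {q} (_ , k , k<N , refl) = cong (term c q) (sym (Finₚ.toℕ-fromℕ< k<N))

record Matching {X : Set} (val : X → ℕ) (c : ℤ) (q N : ℕ) : Set where
  constructor matching
  field
    index : X ↔ Fin N
    coprime : ∀ x → Coprime (val x) ∣ term c q (toℕ (to index x)) ∣

open Matching

StronglyMatchable⇒Matching : ∀ {n c q} → StronglyMatchable n → 1 ≤ q → Coprime ∣ c ∣ q →
  Matching {D n} proj₁ c q (τ n)
StronglyMatchable⇒Matching {n} {c} {q} sm q≥1 c⊥q with sm c q q≥1 (coprime⇒gcd≡1 c⊥q)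
... | ψ , coprime = matching (AP↔Fin {c} {q} ↔-∘ ⤖⇒↔ ψ) λ d →
  subst (λ x → Coprime (proj₁ d) ∣ x ∣) (AP-term {c} {q} {τ n} (Bijection.to ψ d)) (gcd≡1⇒coprime (coprime d))

Matching⇒coprime-bijection : ∀ {m a q M} → 1 ≤ m → Matching {D m} proj₁ a q M →
  Σ[ ψ ∈ D m ⤖ AP a q (τ m) ] ((d : D m) → CoprimeNZ (proj₁ d) (proj₁ (Bijection.to ψ d)))
Matching⇒coprime-bijection {a = a} {q} m≥1 (matching ψ coprime) with ↔⇒≡ (ψ ↔-∘ ↔-sym (D↔Fin[τ] m≥1))
... | refl = ↔⇒⤖ (↔-sym (AP↔Fin {a} {q}) ↔-∘ ψ) , λ d → coprime⇒gcd≡1 (coprime d)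

Matching-transport : ∀ {X Y : Set} {valX : X → ℕ} {valY : Y → ℕ} {c q N} (f : X ↔ Y) →
  (∀ x → valY (to f x) ≡ valX x) → Matching valX c q N → Matching valY c q N
Matching-transport {valY = valY} {c} {q} f val-to (matching ψ coprime) = matching (ψ ↔-∘ ↔-sym f) λ y →
  subst (λ v → Coprime v ∣ term c q (toℕ (to ψ (from f y))) ∣)
    (trans (sym (val-to (from f y))) (cong valY (Inverse.strictlyInverseˡ f y)))
    (coprime (from f y))

module Residues {p} (p-prime : Prime p) (a : ℤ) {q} (q≥1 : 1 ≤ q) (a⊥q : Coprime ∣ a ∣ q) where

  -- The residue class {a + (p m + r) q} read as the coprime progression start + m step, in
  -- such a way that matching e into it matches p ^ i * e into the class.
  record Reduction (r i : ℕ) : Set where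
    field
      start : ℤ
      step : ℕ
      step≥1 : 1 ≤ step
      start⊥step : Coprime ∣ start ∣ step
      lift : ∀ {e} m → ¬ p ∣ e → Coprime e ∣ term start step m ∣ →
        Coprime (p ^ i * e) ∣ term a q (p * m + r) ∣

  reduce-divisible : ∀ r → p ∣ ∣ term a q r ∣ → Reduction r 0
  reduce-divisible r p∣term = record
    { start = c ; step = q ; step≥1 = q≥1 ; start⊥step = c⊥q ; lift = lift }
    where
    open ℤ∣._∣_ (ℤ∣.∣ᵤ⇒∣ {+ p} {term a q r} p∣term) renaming (quotient to c; equality to term≡c*p)

    c⊥q : Coprime ∣ c ∣ q
    c⊥q (d∣c , d∣q) = coprime-term {a} a⊥q r
      (subst (λ z → _ ∣ ∣ z ∣) (sym term≡c*p)
        (subst (_ ∣_) (sym (ℤₚ.abs-* c (+ p))) (∣m⇒∣m*n p d∣c)) , d∣q)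

    ∣term∣≡ : ∀ m → ∣ term a q (p * m + r) ∣ ≡ ∣ term c q m ∣ * p
    ∣term∣≡ m = begin
      ∣ term a q (p * m + r) ∣         ≡⟨ cong ∣_∣ (term-residue a q p m r) ⟩
      ∣ term (term a q r) (p * q) m ∣  ≡⟨ cong (λ z → ∣ term z (p * q) m ∣) term≡c*p ⟩
      ∣ term (c ℤ.* + p) (p * q) m ∣   ≡⟨ cong ∣_∣ (term-scale c q p m) ⟩
      ∣ term c q m ℤ.* + p ∣           ≡⟨ ℤₚ.abs-* (term c q m) (+ p) ⟩
      ∣ term c q m ∣ * p               ∎
      where open ≡-Reasoning

    lift : ∀ {e} m → ¬ p ∣ e → Coprime e ∣ term c q m ∣ → Coprime (p ^ 0 * e) ∣ term a q (p * m + r) ∣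
    lift {e} m p∤e e⊥term = subst₂ Coprime (sym (ℕₚ.*-identityˡ e)) (sym (∣term∣≡ m))
      (coprime-*ʳ e⊥term (prime∤⇒coprime p-prime p∤e))

  reduce-indivisible : ∀ r → ¬ p ∣ ∣ term a q r ∣ → ∀ i → Reduction r i
  reduce-indivisible r p∤term i = record
    { start = term a q r
    ; step = p * q
    ; step≥1 = ℕₚ.*-mono-≤ (>-nonZero⁻¹ p ⦃ prime⇒nonZero p-prime ⦄) q≥1
    ; start⊥step = coprime-*ʳ (prime∤⇒coprime p-prime p∤term) (coprime-term {a} a⊥q r)
    ; lift = lift
    }
    where
    lift : ∀ {e} m → ¬ p ∣ e → Coprime e ∣ term (term a q r) (p * q) m ∣ →
      Coprime (p ^ i * e) ∣ term a q (p * m + r) ∣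
    lift m _ e⊥x = subst (λ z → Coprime (p ^ i * _) ∣ z ∣) (sym (term-residue a q p m r))
      (coprime-^-*ˡ (Coprimality.sym (prime∤⇒coprime p-prime p∤x)) e⊥x i)
      where
      p∤x : ¬ p ∣ ∣ term (term a q r) (p * q) m ∣
      p∤x p∣x = p∤term (∣term∧∣step⇒∣start {c = term a q r} m p∣x (m∣m*n q))

  reduction : ∀ r i → (p ∣ ∣ term a q r ∣ → i ≡ 0) → Reduction r i
  reduction r i p∣term⇒i≡0 with p ∣? ∣ term a q r ∣
  ... | yes p∣term = subst (Reduction r) (sym (p∣term⇒i≡0 p∣term)) (reduce-divisible r p∣term)
  ... | no p∤term = reduce-indivisible r p∤term i

  interleaved-matching : ∀ {n N} → ¬ p ∣ n → (σ : Permutation′ p) →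
    (ρ : ∀ i → Reduction (toℕ (σ ⟨$⟩ʳ i)) (toℕ i)) →
    (∀ i → Matching {D n} proj₁ (Reduction.start (ρ i)) (Reduction.step (ρ i)) N) →
    Matching {Fin p × D n} (λ (i , e) → p ^ toℕ i * proj₁ e) a q (N * p)
  interleaved-matching p∤n σ ρ ψ = matching (interleave σ (index ∘ ψ)) λ (i , e) →
    subst (λ k → Coprime (p ^ toℕ i * proj₁ e) ∣ term a q k ∣) (sym (toℕ-interleave σ (index ∘ ψ) i e))
      (Reduction.lift (ρ i) (toℕ (to (index (ψ i)) e)) (∤⇒∤divisor p∤n e) (coprime (ψ i) e))

proposition6p3 : (n p : ℕ) → 1 ≤ n → StronglyMatchable n → Prime p → ¬ (p ∣ n) →
    StronglyMatchable (p ^ (p ∸ 1) * n)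
proposition6p3 n zero _ _ p-prime _ = contradiction p-prime ¬prime[0]
proposition6p3 n p@(suc j) n≥1 n-matchable p-prime p∤n a q q≥1 gcd[a,q]≡1 =
  Matching⇒coprime-bijection (ℕₚ.*-mono-≤ (ℕₚ.m^n>0 p j) n≥1)
    (Matching-transport (Fin×D↔D[p^j*n] p-prime p∤n j) (λ _ → refl) (interleaved-matching p∤n σ ρ ψ))
  where
  a⊥q : Coprime ∣ a ∣ q
  a⊥q = gcd≡1⇒coprime gcd[a,q]≡1

  open Residues p-prime a q≥1 a⊥q

  divisible-residue-at-0 :
    Σ[ σ ∈ Permutation′ p ] (∀ i → p ∣ ∣ term a q (toℕ (σ ⟨$⟩ʳ i)) ∣ → i ≡ Fin.zero)
  divisible-residue-at-0 = permute-witness-to-zero (λ r → p ∣? ∣ term a q (toℕ r) ∣) λ p∣r p∣s →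
    Finₚ.toℕ-injective (prime∣term-unique {c = a} p-prime a⊥q (Finₚ.toℕ<n _) (Finₚ.toℕ<n _) p∣r p∣s)

  σ : Permutation′ p
  σ = proj₁ divisible-residue-at-0

  ρ : ∀ i → Reduction (toℕ (σ ⟨$⟩ʳ i)) (toℕ i)
  ρ i = reduction (toℕ (σ ⟨$⟩ʳ i)) (toℕ i) (cong toℕ ∘ proj₂ divisible-residue-at-0 i)

  ψ : ∀ i → Matching {D n} proj₁ (Reduction.start (ρ i)) (Reduction.step (ρ i)) (τ n)
  ψ i = StronglyMatchable⇒Matching n-matchable (Reduction.step≥1 (ρ i)) (Reduction.start⊥step (ρ i))
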